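{- Let $(T_1,r_1)$ and $(T_2,r_2)$ be rooted trees with $V(T_1)\cap V(T_2)=\emptyset$, let $(T,r_1)=(T_1,r_1)\circ(T_2,r_2)$, let $f:V(T)\to\{0,1,2\}$, and let $f_1=f|_{V(T_1)}$, $f_2=f|_{V(T_2)}$. Then $(T,f,r_1)\in D$ if and only if either ($(T_1,f_1,r_1)\in D$ and $(T_2,f_2,r_2)\in C$) or ($(T_1,f_1,r_1)\in E$ and $(T_2,f_2,r_2)\in B$).
   Context: For a graph (or forest) $G$, an independent Roman $\{2\}$-dominating function (IR2DF) is a function $f:V(G)\to\{0,1,2\}$ such that every vertex $v$ with $f(v)=0$ satisfies $\sum_{u\in N(v)}f(u)\ge 2$ and the set $\{v: f(v)>0\}$ is independent; the empty function on the empty graph is regarded as an IR2DF. A rooted tree is a pair $(T,r)$ with $T$ a tree and $r\in V(T)$. For rooted trees with disjoint vertex sets, the composition $(T_1,r_1)\circ(T_2,r_2)=(T,r_1)$ has $V(T)=V(T_1)\cup V(T_2)$ and $E(T)=E(T_1)\cup E(T_2)\cup\{r_1r_2\}$. For a rooted tree $(T,r)$ and $f:V(T)\to\{0,1,2\}$, let $IR2DF(T)$ be the set of IR2DFs of $T$, $IR2DF_r(T)=\{f: f\notin IR2DF(T)$ and $f|_{V(T)\setminus\{r\}}\in IR2DF(T-r)\}$, and $f(N[r])=\sum_{u\in N_T[r]}f(u)$. Define the classes of triples: $A=\{(T,f,r): f\in IR2DF(T), f(r)=2\}$; $B=\{(T,f,r): f\in IR2DF(T), f(r)=1\}$; $C=\{(T,f,r):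 f\in IR2DF(T), f(r)=0\}$; $D=\{(T,f,r): f\in IR2DF_r(T), f(N[r])=1\}$; $E=\{(T,f,r): f\in IR2DF_r(T), f(N[r])=0\}$. -}

module Defs where

open import Data.Nat using (ℕ; zero; suc; _+_; _≤_; _≥_)
open import Data.Fin using (Fin; toℕ; _↑ˡ_; _↑ʳ_; splitAt; _≟_)
open import Data.Bool using (Bool; true; false; _∧_; not; if_then_else_)
open import Data.Sum using (_⊎_; inj₁; inj₂)
open import Data.Product using (_×_; Σ; ∃; _,_)
open import Data.List using (List; []; _∷_; length; map; allFin; last)
open import Data.Nat.ListAction using (sum)
open import Data.List.Relation.Unary.Unique.Propositional using (Unique)
open import Data.Maybe using (Maybe; just; nothing)
open import Data.Unit using (⊤)
open import Data.Empty using (⊥)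
open import Relation.Nullary using (¬_)
open import Relation.Nullary.Decidable using (⌊_⌋)
open import Relation.Binary.PropositionalEquality using (_≡_; _≢_)

record Graph (n : ℕ) : Set where
  field
    adj : Fin n → Fin n → Bool

open Graph public

Val : Set
Val = Fin 3

IsSimple : ∀ {n} → Graph n → Set
IsSimple G = (∀ u v → adj G u v ≡ adj G v u) × (∀ v → adj G v v ≡ false)

data Walk {n} (G : Graph n) : Fin n → Fin n → Set where
  here : ∀ {v} → Walk G v v
  step : ∀ {u w v} → adj G u w ≡ true → Walk G w v → Walk G u v

Connected : ∀ {n} → Graph n → Set
Connected G = ∀ u v → Walk G u v

Chain : ∀ {n} → Graph n → List (Fin n) → Set
Chain G [] = ⊤
Chain G (x ∷ []) = ⊤
Chain G (x ∷ y ∷ rest) = (adj G x y ≡ true) × Chain G (y ∷ rest)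

IsCycle : ∀ {n} → Graph n → List (Fin n) → Set
IsCycle G [] = ⊥
IsCycle G (v₀ ∷ rest) =
  Unique (v₀ ∷ rest) × (length (v₀ ∷ rest) ≥ 3) × Chain G (v₀ ∷ rest)
  × ((x : Fin _) → last (v₀ ∷ rest) ≡ just x → adj G x v₀ ≡ true)

Acyclic : ∀ {n} → Graph n → Set
Acyclic G = ∀ vs → ¬ IsCycle G vs

IsTree : ∀ {n} → Graph n → Set
IsTree G = IsSimple G × Connected G × Acyclic G

-- Independent Roman {2}-domination on the subgraph induced by a vertex set S

nbrSum : ∀ {n} → Graph n → (Fin n → Bool) → (Fin n → Val) → Fin n → ℕ
nbrSum {n} G S f v =
  sum (map (λ u → if adj G v u ∧ S u then toℕ (f u) else 0) (allFin n))

IsIR2DFOn : ∀ {n} → Graph n → (Fin n → Bool) → (Fin n → Val) → Set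
IsIR2DFOn {n} G S f =
  (∀ v → S v ≡ true → toℕ (f v) ≡ 0 → nbrSum G S f v ≥ 2)
  × (∀ u v → S u ≡ true → S v ≡ true → adj G u v ≡ true →
       ¬ (toℕ (f u) ≥ 1 × toℕ (f v) ≥ 1))

allV : ∀ {n} → Fin n → Bool
allV _ = true

IR2DF : ∀ {n} → Graph n → (Fin n → Val) → Set
IR2DF G f = IsIR2DFOn G allV f

IR2DFr : ∀ {n} → Graph n → Fin n → (Fin n → Val) → Set
IR2DFr G r f = ¬ IR2DF G f × IsIR2DFOn G (λ v → not ⌊ v ≟ r ⌋) f

closedNbrSum : ∀ {n} → Graph n → (Fin n → Val) → Fin n → ℕ
closedNbrSum G f r = toℕ (f r) + nbrSum G allV f r

ClassA ClassB ClassC ClassD ClassE : ∀ {n} → Graph n → (Fin n → Val) → Fin n → Set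
ClassA T f r = IR2DF T f × toℕ (f r) ≡ 2
ClassB T f r = IR2DF T f × toℕ (f r) ≡ 1
ClassC T f r = IR2DF T f × toℕ (f r) ≡ 0
ClassD T f r = IR2DFr T r f × closedNbrSum T f r ≡ 1
ClassE T f r = IR2DFr T r f × closedNbrSum T f r ≡ 0

-- Composition (T₁,r₁) ∘ (T₂,r₂): vertex set is the disjoint union Fin n₁ ⊎ Fin n₂,
-- encoded as Fin (n₁ + n₂) (left part = T₁, right part = T₂), plus the edge r₁r₂.

compose : ∀ {n₁ n₂} → Graph n₁ → Fin n₁ → Graph n₂ → Fin n₂ → Graph (n₁ + n₂)
compose {n₁} {n₂} T₁ r₁ T₂ r₂ = record { adj = a }
  where
  a : Fin (n₁ + n₂) → Fin (n₁ + n₂) → Bool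
  a x y with splitAt n₁ x | splitAt n₁ y
  ... | inj₁ u | inj₁ v = adj T₁ u v
  ... | inj₂ u | inj₂ v = adj T₂ u v
  ... | inj₁ u | inj₂ v = ⌊ u ≟ r₁ ⌋ ∧ ⌊ v ≟ r₂ ⌋
  ... | inj₂ u | inj₁ v = ⌊ u ≟ r₂ ⌋ ∧ ⌊ v ≟ r₁ ⌋

composeRoot : ∀ {n₁} n₂ → Fin n₁ → Fin (n₁ + n₂)
composeRoot n₂ r₁ = r₁ ↑ˡ n₂

restrictˡ : ∀ {n₁ n₂} {A : Set} → (Fin (n₁ + n₂) → A) → Fin n₁ → A
restrictˡ {n₁} {n₂} f u = f (u ↑ˡ n₂)

restrictʳ : ∀ {n₁ n₂} {A : Set} → (Fin (n₁ + n₂) → A) → Fin n₂ → A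
restrictʳ {n₁} {n₂} f v = f (n₁ ↑ʳ v)

-- The only edge of T₁ ∘ T₂ between the two parts is r₁r₂. Hence f(N[r₁]) = f₁(N[r₁]) + f(r₂),
-- and deleting r₁ leaves T₁ - r₁ and T₂ with no edge between them, so f ∈ IR2DF(T - r₁) iff
-- f₁ ∈ IR2DF(T₁ - r₁) and f₂ ∈ IR2DF(T₂). The condition f(N[r₁]) = 1 therefore splits into
-- f₁(N[r₁]) = 1, f(r₂) = 0 and f₁(N[r₁]) = 0, f(r₂) = 1. In the first case the edge r₁r₂ neither
-- breaks independence nor helps dominate T₁, so, given f₂ ∈ IR2DF(T₂), f ∈ IR2DF(T) iff f₁ ∈ IR2DF(T₁). In the second,
-- r₁ has label 0 and receives weight 0 in T₁ and 1 in T, so neither f₁ nor f is an IR2DF.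
module Submission where

open import Defs
open import Data.Nat using (ℕ; zero; suc; _+_; _≤_; _≥_; z≤n)
open import Data.Nat.Properties using (+-assoc; +-identityʳ; ≤-trans; ≤-reflexive; ≤⇒≯; m≤n+m; m+n≡0⇒m≡0)
open import Data.Nat.ListAction using (sum)
open import Data.Nat.ListAction.Properties using (sum-++)
open import Data.Fin using (Fin; zero; suc; toℕ; _↑ˡ_; _↑ʳ_; _≟_; splitAt; join)
open import Data.Fin.Properties using (splitAt-↑ˡ; splitAt-↑ʳ; join-splitAt; ↑ˡ-injective; suc-injective)
open import Data.Bool using (Bool; true; false; _∧_; not; if_then_else_)
open import Data.Bool.Properties using (∧-zeroʳ; ∧-identityʳ; if-eta)
open import Data.Sum using (_⊎_; inj₁; inj₂; [_,_])
open import Data.Product using (_×_; _,_; proj₁; proj₂)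
open import Data.List using (_∷_; _++_; map; allFin; tabulate)
open import Data.List.Properties using (map-tabulate; map-cong)
open import Relation.Nullary using (¬_; yes; no)
open import Relation.Nullary.Decidable using (⌊_⌋)
open import Relation.Binary.PropositionalEquality
open import Function using (_∘_; id)
open import Function.Bundles using (_⇔_; mk⇔; Equivalence)

m+n≡1⇒m≡1×n≡0⊎m≡0×n≡1 : ∀ m n → m + n ≡ 1 → (m ≡ 1 × n ≡ 0) ⊎ (m ≡ 0 × n ≡ 1)
m+n≡1⇒m≡1×n≡0⊎m≡0×n≡1 zero          (suc zero) refl = inj₂ (refl , refl)
m+n≡1⇒m≡1×n≡0⊎m≡0×n≡1 (suc zero)    zero       refl = inj₁ (refl , refl)
m+n≡1⇒m≡1×n≡0⊎m≡0×n≡1 (suc (suc m)) n          ()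
m+n≡1⇒m≡1×n≡0⊎m≡0×n≡1 (suc zero)    (suc n)    ()

if-∧-congˡ : ∀ {a b s : Bool} {k : ℕ} → a ≡ b → (if a ∧ s then k else 0) ≡ (if b ∧ s then k else 0)
if-∧-congˡ {s = s} {k} = cong (λ a → if a ∧ s then k else 0)

⌊≟⌋-refl : ∀ {n} (r : Fin n) → ⌊ r ≟ r ⌋ ≡ true
⌊≟⌋-refl r = cong ⌊_⌋ (≡-≟-identity _≟_ refl)

⌊≟⌋-≢ : ∀ {n} {u r : Fin n} → u ≢ r → ⌊ u ≟ r ⌋ ≡ false
⌊≟⌋-≢ u≢r = cong ⌊_⌋ (≢-≟-identity _≟_ u≢r)

⌊≟⌋-↑ˡ : ∀ {m} n (u r : Fin m) → ⌊ u ↑ˡ n ≟ r ↑ˡ n ⌋ ≡ ⌊ u ≟ r ⌋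
⌊≟⌋-↑ˡ n u r with u ≟ r
... | yes refl = ⌊≟⌋-refl (u ↑ˡ n)
... | no u≢r   = ⌊≟⌋-≢ (u≢r ∘ ↑ˡ-injective n u r)

↑ʳ≢↑ˡ : ∀ m {n} (j : Fin n) (i : Fin m) → m ↑ʳ j ≢ i ↑ˡ n
↑ʳ≢↑ˡ m {n} j i eq with () ← trans (sym (splitAt-↑ʳ m n j)) (trans (cong (splitAt m) eq) (splitAt-↑ˡ m i n))

↑-elim : ∀ m {n} {P : Fin (m + n) → Set} →
         (∀ i → P (i ↑ˡ n)) → (∀ j → P (m ↑ʳ j)) → ∀ x → P x
↑-elim m {n} {P} Pˡ Pʳ x = subst P (join-splitAt m n x) ([_,_] {C = P ∘ join m n} Pˡ Pʳ (splitAt m x))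

tabulate-↑ : ∀ m {n} {A : Set} (h : Fin (m + n) → A) →
             tabulate h ≡ tabulate (h ∘ (_↑ˡ n)) ++ tabulate (h ∘ (m ↑ʳ_))
tabulate-↑ zero    h = refl
tabulate-↑ (suc m) h = cong (h zero ∷_) (tabulate-↑ m (h ∘ suc))

sum-map-allFin : ∀ {n} (h : Fin n → ℕ) → sum (map h (allFin n)) ≡ sum (tabulate h)
sum-map-allFin h = cong sum (map-tabulate id h)

sum-allFin-↑ : ∀ m {n} (h : Fin (m + n) → ℕ) →
               sum (map h (allFin (m + n)))
                 ≡ sum (map (h ∘ (_↑ˡ n)) (allFin m)) + sum (map (h ∘ (m ↑ʳ_)) (allFin n))
sum-allFin-↑ m {n} h = begin
  sum (map h (allFin (m + n)))                                  ≡⟨ sum-map-allFin h ⟩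
  sum (tabulate h)                                              ≡⟨ cong sum (tabulate-↑ m h) ⟩
  sum (tabulate (h ∘ (_↑ˡ n)) ++ tabulate (h ∘ (m ↑ʳ_)))        ≡⟨ sum-++ (tabulate (h ∘ (_↑ˡ n))) _ ⟩
  sum (tabulate (h ∘ (_↑ˡ n))) + sum (tabulate (h ∘ (m ↑ʳ_)))   ≡⟨ sym (cong₂ _+_ (sum-map-allFin (h ∘ (_↑ˡ n))) (sum-map-allFin (h ∘ (m ↑ʳ_)))) ⟩
  sum (map (h ∘ (_↑ˡ n)) (allFin m)) + sum (map (h ∘ (m ↑ʳ_)) (allFin n)) ∎
  where open ≡-Reasoning

sum-tabulate-zero : ∀ {n} (h : Fin n → ℕ) → (∀ w → h w ≡ 0) → sum (tabulate h) ≡ 0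
sum-tabulate-zero {zero}  h h≡0 = refl
sum-tabulate-zero {suc n} h h≡0 = cong₂ _+_ (h≡0 zero) (sum-tabulate-zero (h ∘ suc) (h≡0 ∘ suc))

sum-tabulate-single : ∀ {n} (h : Fin n → ℕ) (r : Fin n) →
                      (∀ w → w ≢ r → h w ≡ 0) → sum (tabulate h) ≡ h r
sum-tabulate-single h zero h≡0 =
  trans (cong (h zero +_) (sum-tabulate-zero (h ∘ suc) (λ w → h≡0 (suc w) λ ()))) (+-identityʳ _)
sum-tabulate-single h (suc r) h≡0 =
  cong₂ _+_ (h≡0 zero λ ()) (sum-tabulate-single (h ∘ suc) r (λ w w≢r → h≡0 (suc w) (w≢r ∘ suc-injective)))

sum-allFin-⌊≟⌋ : ∀ {n} (c : Bool) (r : Fin n) (S : Fin n → Bool) (g : Fin n → ℕ) →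
                 sum (map (λ w → if (c ∧ ⌊ w ≟ r ⌋) ∧ S w then g w else 0) (allFin n))
                   ≡ (if c ∧ S r then g r else 0)
sum-allFin-⌊≟⌋ {n} c r S g = trans (sum-map-allFin h) (trans (sum-tabulate-single h r off-r) at-r)
  where
  h : Fin n → ℕ
  h w = if (c ∧ ⌊ w ≟ r ⌋) ∧ S w then g w else 0
  off-r : ∀ w → w ≢ r → (if (c ∧ ⌊ w ≟ r ⌋) ∧ S w then g w else 0) ≡ 0
  off-r w w≢r rewrite ⌊≟⌋-≢ w≢r | ∧-zeroʳ c = refl
  at-r : (if (c ∧ ⌊ r ≟ r ⌋) ∧ S r then g r else 0) ≡ (if c ∧ S r then g r else 0)
  at-r rewrite ⌊≟⌋-refl r | ∧-identityʳ c = refl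

allBut : ∀ {n} → Fin n → Fin n → Bool
allBut r v = not ⌊ v ≟ r ⌋

allBut⇒≢ : ∀ {n} {r v : Fin n} → allBut r v ≡ true → v ≢ r
allBut⇒≢ {r = r} e refl with () ← trans (sym e) (cong not (⌊≟⌋-refl r))

Dominating Independent : ∀ {n} → Graph n → (Fin n → Bool) → (Fin n → Val) → Set
Dominating G S f = ∀ v → S v ≡ true → toℕ (f v) ≡ 0 → nbrSum G S f v ≥ 2
Independent G S f = ∀ u v → S u ≡ true → S v ≡ true → adj G u v ≡ true →
                    ¬ (toℕ (f u) ≥ 1 × toℕ (f v) ≥ 1)

nbrSum-cong : ∀ {n} (G : Graph n) {S S′ : Fin n → Bool} (f : Fin n → Val) (v : Fin n) →
              (∀ w → S w ≡ S′ w) → nbrSum G S f v ≡ nbrSum G S′ f v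
nbrSum-cong {n} G f v S≗S′ =
  cong sum (map-cong (λ w → cong (λ s → if adj G v w ∧ s then toℕ (f w) else 0) (S≗S′ w)) (allFin n))

undominated⇒¬IR2DF : ∀ {n} (G : Graph n) (f : Fin n → Val) (r : Fin n) →
                     toℕ (f r) ≡ 0 → closedNbrSum G f r ≤ 1 → ¬ IR2DF G f
undominated⇒¬IR2DF G f r fr≡0 N[r]≤1 (dominating , _) =
  ≤⇒≯ (subst (λ k → k + nbrSum G allV f r ≤ 1) fr≡0 N[r]≤1) (dominating r refl fr≡0)

closedNbrSum≡0⇒¬IR2DF : ∀ {n} (G : Graph n) (f : Fin n → Val) (r : Fin n) →
                        closedNbrSum G f r ≡ 0 → ¬ IR2DF G f
closedNbrSum≡0⇒¬IR2DF G f r N[r]≡0 =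
  undominated⇒¬IR2DF G f r (m+n≡0⇒m≡0 _ N[r]≡0) (subst (_≤ 1) (sym N[r]≡0) z≤n)

module Composition {n₁ n₂} (T₁ : Graph n₁) (r₁ : Fin n₁) (T₂ : Graph n₂) (r₂ : Fin n₂) where

  G : Graph (n₁ + n₂)
  G = compose T₁ r₁ T₂ r₂

  root : Fin (n₁ + n₂)
  root = composeRoot n₂ r₁

  adj-↑ˡ-↑ˡ : ∀ u v → adj G (u ↑ˡ n₂) (v ↑ˡ n₂) ≡ adj T₁ u v
  adj-↑ˡ-↑ˡ u v rewrite splitAt-↑ˡ n₁ u n₂ | splitAt-↑ˡ n₁ v n₂ = refl

  adj-↑ʳ-↑ʳ : ∀ u v → adj G (n₁ ↑ʳ u) (n₁ ↑ʳ v) ≡ adj T₂ u v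
  adj-↑ʳ-↑ʳ u v rewrite splitAt-↑ʳ n₁ n₂ u | splitAt-↑ʳ n₁ n₂ v = refl

  adj-↑ˡ-↑ʳ : ∀ u v → adj G (u ↑ˡ n₂) (n₁ ↑ʳ v) ≡ ⌊ u ≟ r₁ ⌋ ∧ ⌊ v ≟ r₂ ⌋
  adj-↑ˡ-↑ʳ u v rewrite splitAt-↑ˡ n₁ u n₂ | splitAt-↑ʳ n₁ n₂ v = refl

  adj-↑ʳ-↑ˡ : ∀ u v → adj G (n₁ ↑ʳ u) (v ↑ˡ n₂) ≡ ⌊ u ≟ r₂ ⌋ ∧ ⌊ v ≟ r₁ ⌋
  adj-↑ʳ-↑ˡ u v rewrite splitAt-↑ʳ n₁ n₂ u | splitAt-↑ˡ n₁ v n₂ = refl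

  adj-↑ˡ-↑ʳ⇒roots : ∀ u v → adj G (u ↑ˡ n₂) (n₁ ↑ʳ v) ≡ true → u ≡ r₁ × v ≡ r₂
  adj-↑ˡ-↑ʳ⇒roots u v e with u ≟ r₁ | v ≟ r₂ | trans (sym (adj-↑ˡ-↑ʳ u v)) e
  ... | yes u≡r₁ | yes v≡r₂ | _ = u≡r₁ , v≡r₂

  adj-↑ʳ-↑ˡ⇒roots : ∀ u v → adj G (n₁ ↑ʳ u) (v ↑ˡ n₂) ≡ true → u ≡ r₂ × v ≡ r₁
  adj-↑ʳ-↑ˡ⇒roots u v e with u ≟ r₂ | v ≟ r₁ | trans (sym (adj-↑ʳ-↑ˡ u v)) e
  ... | yes u≡r₂ | yes v≡r₁ | _ = u≡r₂ , v≡r₁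

  nbrSum-↑ˡ : ∀ S f u →
              nbrSum G S f (u ↑ˡ n₂)
                ≡ nbrSum T₁ (restrictˡ S) (restrictˡ f) u
                  + (if ⌊ u ≟ r₁ ⌋ ∧ S (n₁ ↑ʳ r₂) then toℕ (f (n₁ ↑ʳ r₂)) else 0)
  nbrSum-↑ˡ S f u = trans (sum-allFin-↑ n₁ _) (cong₂ _+_
    (cong sum (map-cong (λ w → if-∧-congˡ (adj-↑ˡ-↑ˡ u w)) (allFin n₁)))
    (trans (cong sum (map-cong (λ w → if-∧-congˡ (adj-↑ˡ-↑ʳ u w)) (allFin n₂)))
           (sum-allFin-⌊≟⌋ ⌊ u ≟ r₁ ⌋ r₂ (S ∘ (n₁ ↑ʳ_)) (toℕ ∘ f ∘ (n₁ ↑ʳ_)))))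

  nbrSum-↑ʳ : ∀ S f v →
              nbrSum G S f (n₁ ↑ʳ v)
                ≡ (if ⌊ v ≟ r₂ ⌋ ∧ S root then toℕ (f root) else 0)
                  + nbrSum T₂ (restrictʳ {n₁} S) (restrictʳ {n₁} f) v
  nbrSum-↑ʳ S f v = trans (sum-allFin-↑ n₁ _) (cong₂ _+_
    (trans (cong sum (map-cong (λ w → if-∧-congˡ (adj-↑ʳ-↑ˡ v w)) (allFin n₁)))
           (sum-allFin-⌊≟⌋ ⌊ v ≟ r₂ ⌋ r₁ (S ∘ (_↑ˡ n₂)) (toℕ ∘ f ∘ (_↑ˡ n₂))))
    (cong sum (map-cong (λ w → if-∧-congˡ (adj-↑ʳ-↑ʳ v w)) (allFin n₂))))

  allBut-↑ˡ : ∀ u → allBut root (u ↑ˡ n₂) ≡ allBut r₁ u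
  allBut-↑ˡ u = cong not (⌊≟⌋-↑ˡ n₂ u r₁)

  allBut-↑ʳ : ∀ v → allBut root (n₁ ↑ʳ v) ≡ true
  allBut-↑ʳ v = cong not (⌊≟⌋-≢ (↑ʳ≢↑ˡ n₁ v r₁))

  module _ (f : Fin (n₁ + n₂) → Val) where

    f₁ : Fin n₁ → Val
    f₁ = restrictˡ f

    f₂ : Fin n₂ → Val
    f₂ = restrictʳ {n₁} f

    closedNbrSum-root : closedNbrSum G f root ≡ closedNbrSum T₁ f₁ r₁ + toℕ (f₂ r₂)
    closedNbrSum-root = begin
      toℕ (f₁ r₁) + nbrSum G allV f root
        ≡⟨ cong (toℕ (f₁ r₁) +_) (nbrSum-↑ˡ allV f r₁) ⟩
      toℕ (f₁ r₁) + (nbrSum T₁ allV f₁ r₁ + (if ⌊ r₁ ≟ r₁ ⌋ ∧ true then toℕ (f₂ r₂) else 0))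
        ≡⟨ cong (λ b → toℕ (f₁ r₁) + (nbrSum T₁ allV f₁ r₁ + (if b ∧ true then toℕ (f₂ r₂) else 0))) (⌊≟⌋-refl r₁) ⟩
      toℕ (f₁ r₁) + (nbrSum T₁ allV f₁ r₁ + toℕ (f₂ r₂))
        ≡⟨ sym (+-assoc (toℕ (f₁ r₁)) _ _) ⟩
      closedNbrSum T₁ f₁ r₁ + toℕ (f₂ r₂) ∎
      where open ≡-Reasoning

    nbrSum-allBut-↑ˡ : ∀ u → u ≢ r₁ → nbrSum G (allBut root) f (u ↑ˡ n₂) ≡ nbrSum T₁ (allBut r₁) f₁ u
    nbrSum-allBut-↑ˡ u u≢r₁ = begin
      nbrSum G (allBut root) f (u ↑ˡ n₂)
        ≡⟨ nbrSum-↑ˡ (allBut root) f u ⟩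
      nbrSum T₁ (restrictˡ (allBut root)) f₁ u + (if ⌊ u ≟ r₁ ⌋ ∧ allBut root (n₁ ↑ʳ r₂) then toℕ (f₂ r₂) else 0)
        ≡⟨ cong₂ _+_ (nbrSum-cong T₁ f₁ u allBut-↑ˡ) (if-∧-congˡ (⌊≟⌋-≢ u≢r₁)) ⟩
      nbrSum T₁ (allBut r₁) f₁ u + 0
        ≡⟨ +-identityʳ _ ⟩
      nbrSum T₁ (allBut r₁) f₁ u ∎
      where open ≡-Reasoning

    nbrSum-allBut-↑ʳ : ∀ v → nbrSum G (allBut root) f (n₁ ↑ʳ v) ≡ nbrSum T₂ allV f₂ v
    nbrSum-allBut-↑ʳ v = trans (nbrSum-↑ʳ (allBut root) f v) (cong₂ _+_ root-excluded (nbrSum-cong T₂ f₂ v allBut-↑ʳ))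
      where
      root-excluded : (if ⌊ v ≟ r₂ ⌋ ∧ allBut root root then toℕ (f root) else 0) ≡ 0
      root-excluded rewrite ⌊≟⌋-refl root | ∧-zeroʳ ⌊ v ≟ r₂ ⌋ = refl

    IR2DF-allBut-root⇔ : IsIR2DFOn G (allBut root) f ⇔ (IsIR2DFOn T₁ (allBut r₁) f₁ × IR2DF T₂ f₂)
    IR2DF-allBut-root⇔ = mk⇔ split glue
      where
      split : IsIR2DFOn G (allBut root) f → IsIR2DFOn T₁ (allBut r₁) f₁ × IR2DF T₂ f₂
      split (dom , ind) = (dom₁ , ind₁) , (dom₂ , ind₂)
        where
        dom₁ : Dominating T₁ (allBut r₁) f₁
        dom₁ u hu hz = subst (_≥ 2) (nbrSum-allBut-↑ˡ u (allBut⇒≢ hu)) (dom (u ↑ˡ n₂) (trans (allBut-↑ˡ u) hu) hz)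
        ind₁ : Independent T₁ (allBut r₁) f₁
        ind₁ u v hu hv e = ind _ _ (trans (allBut-↑ˡ u) hu) (trans (allBut-↑ˡ v) hv) (trans (adj-↑ˡ-↑ˡ u v) e)
        dom₂ : Dominating T₂ allV f₂
        dom₂ v _ hz = subst (_≥ 2) (nbrSum-allBut-↑ʳ v) (dom (n₁ ↑ʳ v) (allBut-↑ʳ v) hz)
        ind₂ : Independent T₂ allV f₂
        ind₂ u v _ _ e = ind _ _ (allBut-↑ʳ u) (allBut-↑ʳ v) (trans (adj-↑ʳ-↑ʳ u v) e)
      glue : IsIR2DFOn T₁ (allBut r₁) f₁ × IR2DF T₂ f₂ → IsIR2DFOn G (allBut root) f
      glue ((dom₁ , ind₁) , (dom₂ , ind₂)) = dom , ind
        where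
        dom : Dominating G (allBut root) f
        dom = ↑-elim n₁
          (λ u hu hz → let hu₁ = trans (sym (allBut-↑ˡ u)) hu in
                       subst (_≥ 2) (sym (nbrSum-allBut-↑ˡ u (allBut⇒≢ hu₁))) (dom₁ u hu₁ hz))
          (λ v _ hz → subst (_≥ 2) (sym (nbrSum-allBut-↑ʳ v)) (dom₂ v refl hz))
        ind : Independent G (allBut root) f
        ind = ↑-elim n₁
          (λ u → ↑-elim n₁
            (λ v hu hv e → ind₁ u v (trans (sym (allBut-↑ˡ u)) hu) (trans (sym (allBut-↑ˡ v)) hv) (trans (sym (adj-↑ˡ-↑ˡ u v)) e))
            (λ v hu _ e _ → allBut⇒≢ (trans (sym (allBut-↑ˡ u)) hu) (proj₁ (adj-↑ˡ-↑ʳ⇒roots u v e))))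
          (λ u → ↑-elim n₁
            (λ v _ hv e _ → allBut⇒≢ (trans (sym (allBut-↑ˡ v)) hv) (proj₂ (adj-↑ʳ-↑ˡ⇒roots u v e)))
            (λ v _ _ e → ind₂ u v refl refl (trans (sym (adj-↑ʳ-↑ʳ u v)) e)))

    module _ (f₂r₂≡0 : toℕ (f₂ r₂) ≡ 0) where

      r₂-unlabelled : ∀ {v} → v ≡ r₂ → ¬ toℕ (f₂ v) ≥ 1
      r₂-unlabelled refl f₂r₂≥1 with () ← subst (1 ≤_) f₂r₂≡0 f₂r₂≥1

      nbrSum-↑ˡ-unlabelled : ∀ u → nbrSum G allV f (u ↑ˡ n₂) ≡ nbrSum T₁ allV f₁ u
      nbrSum-↑ˡ-unlabelled u = begin
        nbrSum G allV f (u ↑ˡ n₂)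
          ≡⟨ nbrSum-↑ˡ allV f u ⟩
        nbrSum T₁ allV f₁ u + (if ⌊ u ≟ r₁ ⌋ ∧ true then toℕ (f₂ r₂) else 0)
          ≡⟨ cong (λ k → nbrSum T₁ allV f₁ u + (if ⌊ u ≟ r₁ ⌋ ∧ true then k else 0)) f₂r₂≡0 ⟩
        nbrSum T₁ allV f₁ u + (if ⌊ u ≟ r₁ ⌋ ∧ true then 0 else 0)
          ≡⟨ cong (nbrSum T₁ allV f₁ u +_) (if-eta (⌊ u ≟ r₁ ⌋ ∧ true)) ⟩
        nbrSum T₁ allV f₁ u + 0
          ≡⟨ +-identityʳ _ ⟩
        nbrSum T₁ allV f₁ u ∎
        where open ≡-Reasoning

      IR2DF-compose⇔ : IR2DF T₂ f₂ → IR2DF G f ⇔ IR2DF T₁ f₁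
      IR2DF-compose⇔ (dom₂ , ind₂) = mk⇔ restrict glue
        where
        restrict : IR2DF G f → IR2DF T₁ f₁
        restrict (dom , ind) = dom₁ , ind₁
          where
          dom₁ : Dominating T₁ allV f₁
          dom₁ u _ hz = subst (_≥ 2) (nbrSum-↑ˡ-unlabelled u) (dom (u ↑ˡ n₂) refl hz)
          ind₁ : Independent T₁ allV f₁
          ind₁ u v _ _ e = ind _ _ refl refl (trans (adj-↑ˡ-↑ˡ u v) e)
        glue : IR2DF T₁ f₁ → IR2DF G f
        glue (dom₁ , ind₁) = dom , ind
          where
          dom : Dominating G allV f
          dom = ↑-elim n₁
            (λ u _ hz → subst (_≥ 2) (sym (nbrSum-↑ˡ-unlabelled u)) (dom₁ u refl hz))
            (λ v _ hz → subst (_≥ 2) (sym (nbrSum-↑ʳ allV f v)) (≤-trans (dom₂ v refl hz) (m≤n+m _ _)))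
          ind : Independent G allV f
          ind = ↑-elim n₁
            (λ u → ↑-elim n₁
              (λ v _ _ e → ind₁ u v refl refl (trans (sym (adj-↑ˡ-↑ˡ u v)) e))
              (λ v _ _ e labelled → r₂-unlabelled (proj₂ (adj-↑ˡ-↑ʳ⇒roots u v e)) (proj₂ labelled)))
            (λ u → ↑-elim n₁
              (λ v _ _ e labelled → r₂-unlabelled (proj₁ (adj-↑ʳ-↑ˡ⇒roots u v e)) (proj₁ labelled))
              (λ v _ _ e → ind₂ u v refl refl (trans (sym (adj-↑ʳ-↑ʳ u v)) e)))

lemma5 : ∀ {n₁ n₂} (T₁ : Graph n₁) (r₁ : Fin n₁) (T₂ : Graph n₂) (r₂ : Fin n₂)
         → IsTree T₁ → IsTree T₂
         → (f : Fin (n₁ + n₂) → Val)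
         → ClassD (compose T₁ r₁ T₂ r₂) f (composeRoot n₂ r₁)
           ⇔ ((ClassD T₁ (restrictˡ f) r₁ × ClassC T₂ (restrictʳ {n₁} f) r₂)
              ⊎ (ClassE T₁ (restrictˡ f) r₁ × ClassB T₂ (restrictʳ {n₁} f) r₂))
lemma5 T₁ r₁ T₂ r₂ _ _ f = mk⇔ split glue
  where
  open Composition T₁ r₁ T₂ r₂
  open Equivalence

  Cases : Set
  Cases = (ClassD T₁ (f₁ f) r₁ × ClassC T₂ (f₂ f) r₂) ⊎ (ClassE T₁ (f₁ f) r₁ × ClassB T₂ (f₂ f) r₂)

  split : ClassD G f root → Cases
  split ((¬ir , ir⁻) , N[root]≡1)
    with to (IR2DF-allBut-root⇔ f) ir⁻ | m+n≡1⇒m≡1×n≡0⊎m≡0×n≡1 _ _ (trans (sym (closedNbrSum-root f)) N[root]≡1)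
  ... | ir₁⁻ , ir₂ | inj₁ (N[r₁]≡1 , f₂r₂≡0) =
    inj₁ (((¬ir ∘ from (IR2DF-compose⇔ f f₂r₂≡0 ir₂) , ir₁⁻) , N[r₁]≡1) , ir₂ , f₂r₂≡0)
  ... | ir₁⁻ , ir₂ | inj₂ (N[r₁]≡0 , f₂r₂≡1) =
    inj₂ (((closedNbrSum≡0⇒¬IR2DF T₁ (f₁ f) r₁ N[r₁]≡0 , ir₁⁻) , N[r₁]≡0) , ir₂ , f₂r₂≡1)

  glue : Cases → ClassD G f root
  glue (inj₁ (((¬ir₁ , ir₁⁻) , N[r₁]≡1) , ir₂ , f₂r₂≡0)) =
    (¬ir₁ ∘ to (IR2DF-compose⇔ f f₂r₂≡0 ir₂) , from (IR2DF-allBut-root⇔ f) (ir₁⁻ , ir₂)) ,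
    trans (closedNbrSum-root f) (cong₂ _+_ N[r₁]≡1 f₂r₂≡0)
  glue (inj₂ (((_ , ir₁⁻) , N[r₁]≡0) , ir₂ , f₂r₂≡1)) =
    (¬ir , from (IR2DF-allBut-root⇔ f) (ir₁⁻ , ir₂)) , N[root]≡1
    where
    N[root]≡1 : closedNbrSum G f root ≡ 1
    N[root]≡1 = trans (closedNbrSum-root f) (cong₂ _+_ N[r₁]≡0 f₂r₂≡1)
    ¬ir : ¬ IR2DF G f
    ¬ir = undominated⇒¬IR2DF G f root (m+n≡0⇒m≡0 _ N[r₁]≡0) (≤-reflexive N[root]≡1)
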